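{- Let $n\in\mathbb N$ and let $A\subseteq\mathbb Z_n\setminus\{0\}$ with $A=-A$, such that $C_n(A)$ is not a complete graph. Then $C_n(A)$ has adjacent twins if and only if there exists $w\in\mathbb Z_n$ with $w\neq0$ and $w\notin U(n)$ such that $A\cup\{0\}$ is a union of cosets of $\langle w\rangle$. In this case, the adjacent twin classes are the cosets of $\langle w\rangle$, where $w$ is an element of maximum additive order satisfying the preceding condition.
   Context: The circulant graph $C_n(A)$ has vertex set $\mathbb Z_n$, with $u,v$ adjacent iff $u-v\in A$. $U(n)$ is the unit group of $\mathbb Z_n$. Distinct vertices $u,v$ are adjacent twins if $N[u]=N[v]$, where $N[u]=N(u)\cup\{u\}$ is the closed neighborhood; the adjacent twin classes are the equivalence classes of the relation $N[u]=N[v]$. -}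

module Defs where

open import Data.Nat using (ℕ; zero; suc; _+_; _*_; _∸_; _≤_; NonZero)
open import Data.Nat.DivMod using (_%_; m%n<n)
open import Data.Fin using (Fin; toℕ; fromℕ<)
open import Data.Fin.Subset using (Subset; _∈_; _∉_)
open import Data.Product using (Σ; ∃; _×_)
open import Data.Sum using (_⊎_)
open import Relation.Nullary using (¬_)
open import Relation.Binary.PropositionalEquality using (_≡_; _≢_)
open import Function.Bundles using (_⇔_)

module _ {n : ℕ} .{{_ : NonZero n}} where

  [_] : ℕ → Fin n
  [ k ] = fromℕ< (m%n<n k n)

  𝟘 : Fin n
  𝟘 = [ 0 ]

  infixl 6 _⊕_ _⊖_
  infixl 7 _·_

  _⊕_ : Fin n → Fin n → Fin n
  x ⊕ y = [ toℕ x + toℕ y ]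

  ⊝_ : Fin n → Fin n
  ⊝ x = [ n ∸ toℕ x ]

  _⊖_ : Fin n → Fin n → Fin n
  x ⊖ y = x ⊕ (⊝ y)

  _·_ : ℕ → Fin n → Fin n
  k · w = [ k * toℕ w ]

  IsUnit : Fin n → Set
  IsUnit x = ∃ λ (y : Fin n) → [ toℕ x * toℕ y ] ≡ [ 1 ]

  _∈⟨_⟩ : Fin n → Fin n → Set
  x ∈⟨ w ⟩ = ∃ λ (k : ℕ) → x ≡ k · w

  _∈_+⟨_⟩ : Fin n → Fin n → Fin n → Set
  x ∈ u +⟨ w ⟩ = ∃ λ (k : ℕ) → x ≡ u ⊕ k · w

  HasOrder : Fin n → ℕ → Set
  HasOrder w k = 1 ≤ k × k · w ≡ 𝟘 × (∀ j → 1 ≤ j → j · w ≡ 𝟘 → k ≤ j)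

  _∈A∪0_ : Fin n → Subset n → Set
  x ∈A∪0 A = x ∈ A ⊎ x ≡ 𝟘

  UnionOfCosets : Subset n → Fin n → Set
  UnionOfCosets A w = ∀ x → x ∈A∪0 A → ∀ y → y ∈ x +⟨ w ⟩ → y ∈A∪0 A

  Good : Subset n → Fin n → Set
  Good A w = w ≢ 𝟘 × ¬ IsUnit w × UnionOfCosets A w

  -- circulant graph C_n(A): u ~ v iff u - v ∈ A (A ⊆ ℤ_n∖{0}, so no loops)
  Adj : Subset n → Fin n → Fin n → Set
  Adj A u v = (u ⊖ v) ∈ A

  _∈N[_]_ : Fin n → Fin n → Subset n → Set
  x ∈N[ u ] A = x ≡ u ⊎ Adj A u x

  SameClosedNbhd : Subset n → Fin n → Fin n → Set
  SameClosedNbhd A u v = ∀ x → (x ∈N[ u ] A) ⇔ (x ∈N[ v ] A)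

  IsComplete : Subset n → Set
  IsComplete A = ∀ u v → u ≢ v → Adj A u v

  HasAdjacentTwins : Subset n → Set
  HasAdjacentTwins A = ∃ λ u → ∃ λ v → u ≢ v × SameClosedNbhd A u v

{-# OPTIONS --safe #-}

-- The periods of A ∪ {0}, i.e. the d with A ∪ {0} + d ⊆ A ∪ {0}, form a subgroup H of ℤ_n,
-- and N[u] = N[v] exactly when v − u ∈ H, so the adjacent twin classes are the cosets of H.
-- A ∪ {0} is a union of cosets of ⟨w⟩ iff w ∈ H, and H contains a unit only if C_n(A) is
-- complete. Finally an element w of maximal order in a subgroup H of ℤ_n generates it:
-- for δ ∈ H, Bézout puts h = gcd(w, n, δ) in H, and n/h = ord h ≤ ord w ≤ n/gcd(w, n)
-- forces gcd(w, n) ∣ δ.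
module Submission where

open import Defs
open import Level using (0ℓ)
open import Algebra.Bundles using (AbelianGroup)
import Algebra.Properties.AbelianGroup as AbelianGroupProperties
open import Data.Nat using (ℕ; zero; suc; _+_; _*_; _∸_; _≤_; NonZero; ≢-nonZero; ≢-nonZero⁻¹; >-nonZero; >-nonZero⁻¹)
open import Data.Nat.Properties
  using (+-comm; +-assoc; *-comm; *-assoc; *-identityˡ; *-identityʳ; *-zeroʳ; *-distribʳ-+;
         m+[n∸m]≡n; m∸n+n≡m; <⇒≤; ≤-refl; ≤-trans; ≤-antisym; n≢0⇒n>0; *-cancelˡ-≤; *-monoˡ-≤)
open import Data.Nat.DivMod using (_%_; m%n<n; m%n%n≡m%n; m<n⇒m%n≡m; m*n%n≡0; %-distribˡ-+; %-distribˡ-*)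
open import Data.Nat.Divisibility
  using (_∣_; quotient; m∣n⇒n≡quotient*m; m%n≡0⇒n∣m; n∣m⇒m%n≡0; ∣-refl; ∣-reflexive; ∣-trans;
         ∣⇒≤; m∣m*n; *-monoʳ-∣; *-cancelʳ-∣)
open import Data.Nat.GCD using (gcd; gcd-GCD; gcd[m,n]∣m; gcd[m,n]∣n; module Bézout)
open import Data.Fin using (Fin; toℕ; _≟_)
open import Data.Fin.Properties using (toℕ-injective; toℕ<n; toℕ-fromℕ<)
open import Data.Fin.Subset using (Subset; _∈_; _∉_)
open import Data.Product using (∃; _×_; _,_; proj₁; proj₂)
open import Data.Sum using (inj₁; inj₂; [_,_]′)
open import Data.Empty using (⊥-elim)
open import Function.Base using (id)
open import Function.Bundles using (_⇔_; mk⇔; Equivalence)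
open import Relation.Nullary using (¬_; yes; no)
open import Relation.Binary.PropositionalEquality
  using (_≡_; _≢_; refl; sym; trans; cong; cong₂; subst; isEquivalence; module ≡-Reasoning)

open Equivalence using (to; from)

module _ {n : ℕ} .{{_ : NonZero n}} where

  open ≡-Reasoning

  toℕ-[] : ∀ a → toℕ ([_] {n} a) ≡ a % n
  toℕ-[] a = toℕ-fromℕ< (m%n<n a n)

  %-≡⇒[]-≡ : ∀ {a b} → a % n ≡ b % n → [_] {n} a ≡ [ b ]
  %-≡⇒[]-≡ {a} {b} a≡b = toℕ-injective (trans (toℕ-[] a) (trans a≡b (sym (toℕ-[] b))))

  [toℕ] : (x : Fin n) → [ toℕ x ] ≡ x
  [toℕ] x = toℕ-injective (trans (toℕ-[] (toℕ x)) (m<n⇒m%n≡m (toℕ<n x)))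

  []-+ : ∀ a b → [_] {n} a ⊕ [ b ] ≡ [ a + b ]
  []-+ a b = %-≡⇒[]-≡ (begin
    (toℕ [ a ] + toℕ [ b ]) % n ≡⟨ cong₂ (λ x y → (x + y) % n) (toℕ-[] a) (toℕ-[] b) ⟩
    (a % n + b % n) % n         ≡⟨ %-distribˡ-+ a b n ⟨
    (a + b) % n                 ∎)

  []-* : ∀ k a → k · [_] {n} a ≡ [ k * a ]
  []-* k a = %-≡⇒[]-≡ (begin
    (k * toℕ [ a ]) % n           ≡⟨ cong (λ x → (k * x) % n) (toℕ-[] a) ⟩
    (k * (a % n)) % n             ≡⟨ %-distribˡ-* k (a % n) n ⟩
    (k % n * (a % n % n)) % n     ≡⟨ cong (λ x → (k % n * x) % n) (m%n%n≡m%n a n) ⟩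
    (k % n * (a % n)) % n         ≡⟨ %-distribˡ-* k a n ⟨
    (k * a) % n                   ∎)

  []≡𝟘⇒∣ : ∀ {a} → [_] {n} a ≡ 𝟘 → n ∣ a
  []≡𝟘⇒∣ {a} [a]≡𝟘 = m%n≡0⇒n∣m a n (begin
    a % n      ≡⟨ toℕ-[] a ⟨
    toℕ [ a ]  ≡⟨ cong toℕ [a]≡𝟘 ⟩
    toℕ 𝟘      ≡⟨ toℕ-[] 0 ⟩
    0 % n      ≡⟨ m*n%n≡0 0 n ⟩
    0          ∎)

  ∣⇒[]≡𝟘 : ∀ {a} → n ∣ a → [_] {n} a ≡ 𝟘
  ∣⇒[]≡𝟘 {a} n∣a = %-≡⇒[]-≡ (trans (n∣m⇒m%n≡0 a n n∣a) (sym (m*n%n≡0 0 n)))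

  ⊕-comm : (x y : Fin n) → x ⊕ y ≡ y ⊕ x
  ⊕-comm x y = cong [_] (+-comm (toℕ x) (toℕ y))

  ⊕-assoc : (x y z : Fin n) → (x ⊕ y) ⊕ z ≡ x ⊕ (y ⊕ z)
  ⊕-assoc x y z = begin
    [ toℕ x + toℕ y ] ⊕ z           ≡⟨ cong ([ toℕ x + toℕ y ] ⊕_) ([toℕ] z) ⟨
    [ toℕ x + toℕ y ] ⊕ [ toℕ z ]   ≡⟨ []-+ (toℕ x + toℕ y) (toℕ z) ⟩
    [ toℕ x + toℕ y + toℕ z ]       ≡⟨ cong [_] (+-assoc (toℕ x) (toℕ y) (toℕ z)) ⟩
    [ toℕ x + (toℕ y + toℕ z) ]     ≡⟨ []-+ (toℕ x) (toℕ y + toℕ z) ⟨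
    [ toℕ x ] ⊕ (y ⊕ z)             ≡⟨ cong (_⊕ (y ⊕ z)) ([toℕ] x) ⟩
    x ⊕ (y ⊕ z)                     ∎

  ⊕-identityˡ : (x : Fin n) → 𝟘 ⊕ x ≡ x
  ⊕-identityˡ x = begin
    𝟘 ⊕ x          ≡⟨ cong (𝟘 ⊕_) ([toℕ] x) ⟨
    𝟘 ⊕ [ toℕ x ]  ≡⟨ []-+ 0 (toℕ x) ⟩
    [ toℕ x ]      ≡⟨ [toℕ] x ⟩
    x              ∎

  ⊕-identityʳ : (x : Fin n) → x ⊕ 𝟘 ≡ x
  ⊕-identityʳ x = trans (⊕-comm x 𝟘) (⊕-identityˡ x)

  ⊕-inverseʳ : (x : Fin n) → x ⊕ ⊝ x ≡ 𝟘
  ⊕-inverseʳ x = begin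
    x ⊕ ⊝ x                  ≡⟨ cong (_⊕ ⊝ x) ([toℕ] x) ⟨
    [ toℕ x ] ⊕ ⊝ x          ≡⟨ []-+ (toℕ x) (n ∸ toℕ x) ⟩
    [ toℕ x + (n ∸ toℕ x) ]  ≡⟨ cong [_] (m+[n∸m]≡n (<⇒≤ (toℕ<n x))) ⟩
    [ n ]                    ≡⟨ ∣⇒[]≡𝟘 ∣-refl ⟩
    𝟘                        ∎

  ⊕-inverseˡ : (x : Fin n) → ⊝ x ⊕ x ≡ 𝟘
  ⊕-inverseˡ x = trans (⊕-comm (⊝ x) x) (⊕-inverseʳ x)

  ⊕-abelianGroup : AbelianGroup 0ℓ 0ℓ
  ⊕-abelianGroup = record
    { Carrier        = Fin n
    ; _≈_            = _≡_
    ; _∙_            = _⊕_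
    ; ε              = 𝟘
    ; _⁻¹            = ⊝_
    ; isAbelianGroup = record
      { isGroup = record
        { isMonoid = record
          { isSemigroup = record
            { isMagma = record { isEquivalence = isEquivalence ; ∙-cong = cong₂ _⊕_ }
            ; assoc   = ⊕-assoc
            }
          ; identity = ⊕-identityˡ , ⊕-identityʳ
          }
        ; inverse = ⊕-inverseˡ , ⊕-inverseʳ
        ; ⁻¹-cong = cong ⊝_
        }
      ; comm = ⊕-comm
      }
    }

  open AbelianGroupProperties ⊕-abelianGroup
    using (xyx⁻¹≈y; x∙y⁻¹≈ε⇒x≈y; //-rightDividesˡ; //-rightDividesʳ; identityʳ-unique; inverseˡ-unique)

  ⊕-⊖-cancel : (x u : Fin n) → x ⊕ (u ⊖ x) ≡ u
  ⊕-⊖-cancel x u = trans (⊕-comm x (u ⊖ x)) (//-rightDividesˡ x u)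

  ⊖∈⟨⟩⇒∈+⟨⟩ : ∀ {u v w : Fin n} → (v ⊖ u) ∈⟨ w ⟩ → v ∈ u +⟨ w ⟩
  ⊖∈⟨⟩⇒∈+⟨⟩ {u} {v} (j , v⊖u≡j·w) = j , trans (sym (⊕-⊖-cancel u v)) (cong (u ⊕_) v⊖u≡j·w)

  ·-identityˡ : (x : Fin n) → 1 · x ≡ x
  ·-identityˡ x = trans (cong [_] (*-identityˡ (toℕ x))) ([toℕ] x)

  ·-distribʳ : ∀ j k (x : Fin n) → (j + k) · x ≡ j · x ⊕ k · x
  ·-distribʳ j k x = trans (cong [_] (*-distribʳ-+ (toℕ x) j k)) (sym ([]-+ (j * toℕ x) (k * toℕ x)))

  ⊝≡[n∸1]· : (x : Fin n) → ⊝ x ≡ (n ∸ 1) · x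
  ⊝≡[n∸1]· x = sym (inverseˡ-unique ((n ∸ 1) · x) x (begin
    (n ∸ 1) · x ⊕ x        ≡⟨ cong ((n ∸ 1) · x ⊕_) (·-identityˡ x) ⟨
    (n ∸ 1) · x ⊕ 1 · x    ≡⟨ ·-distribʳ (n ∸ 1) 1 x ⟨
    (n ∸ 1 + 1) · x        ≡⟨ cong (_· x) (m∸n+n≡m (>-nonZero⁻¹ n)) ⟩
    n · x                  ≡⟨ ∣⇒[]≡𝟘 (m∣m*n (toℕ x)) ⟩
    𝟘                      ∎))

  IsUnit⇒generates : ∀ {d} → IsUnit d → ∀ z → z ∈⟨ d ⟩
  IsUnit⇒generates {d} (y , dy≡1) z = toℕ z * toℕ y , (begin
    z                                ≡⟨ [toℕ] z ⟨
    [ toℕ z ]                        ≡⟨ cong [_] (*-identityʳ (toℕ z)) ⟨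
    [ toℕ z * 1 ]                    ≡⟨ []-* (toℕ z) 1 ⟨
    toℕ z · [ 1 ]                    ≡⟨ cong (toℕ z ·_) dy≡1 ⟨
    toℕ z · [ toℕ d * toℕ y ]        ≡⟨ []-* (toℕ z) (toℕ d * toℕ y) ⟩
    [ toℕ z * (toℕ d * toℕ y) ]      ≡⟨ cong (λ m → [ toℕ z * m ]) (*-comm (toℕ d) (toℕ y)) ⟩
    [ toℕ z * (toℕ y * toℕ d) ]      ≡⟨ cong [_] (*-assoc (toℕ z) (toℕ y) (toℕ d)) ⟨
    (toℕ z * toℕ y) · d              ∎)

  record IsSubmonoid (P : Fin n → Set) : Set where
    field
      𝟘-closed : P 𝟘
      ⊕-closed : ∀ {x y} → P x → P y → P (x ⊕ y)

    ·-closed : ∀ k {x} → P x → P (k · x)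
    ·-closed zero          _  = 𝟘-closed
    ·-closed (suc k) {x} px =
      subst P (sym (trans (·-distribʳ 1 k x) (cong (_⊕ k · x) (·-identityˡ x))))
        (⊕-closed px (·-closed k px))

    ⊝-closed : ∀ {x} → P x → P (⊝ x)
    ⊝-closed {x} px = subst P (sym (⊝≡[n∸1]· x)) (·-closed (n ∸ 1) px)

    []-*-closed : ∀ k {a} → P [ a ] → P [ k * a ]
    []-*-closed k {a} pa = subst P ([]-* k a) (·-closed k pa)

    []-∸-closed : ∀ {a b} → P [ a + b ] → P [ b ] → P [ a ]
    []-∸-closed {a} {b} pab pb = subst P [a+b]⊖[b]≡[a] (⊕-closed pab (⊝-closed pb))
      where
      [a+b]⊖[b]≡[a] : [ a + b ] ⊖ [ b ] ≡ [ a ]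
      [a+b]⊖[b]≡[a] = trans (cong (_⊖ [ b ]) (sym ([]-+ a b))) (//-rightDividesʳ [ b ] [ a ])

    gcd-closed : ∀ {a b} → P [ a ] → P [ b ] → P [ gcd a b ]
    gcd-closed {a} {b} pa pb with Bézout.identity (gcd-GCD a b)
    ... | Bézout.+- x y eq =
      []-∸-closed (subst (λ c → P [ c ]) (sym eq) ([]-*-closed x pa)) ([]-*-closed y pb)
    ... | Bézout.-+ x y eq =
      []-∸-closed (subst (λ c → P [ c ]) (sym eq) ([]-*-closed y pb)) ([]-*-closed x pa)

    gcd-n-closed : ∀ {x} → P x → P [ gcd (toℕ x) n ]
    gcd-n-closed {x} px =
      gcd-closed (subst P (sym ([toℕ] x)) px) (subst P (sym (∣⇒[]≡𝟘 ∣-refl)) 𝟘-closed)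

  open IsSubmonoid

  ⟨⟩-isSubmonoid : (w : Fin n) → IsSubmonoid (_∈⟨ w ⟩)
  ⟨⟩-isSubmonoid w = record
    { 𝟘-closed = 0 , refl
    ; ⊕-closed = λ { (j , refl) (k , refl) → j + k , sym (·-distribʳ j k w) }
    }

  HasOrder-𝟘⇒≤1 : ∀ {k} → HasOrder 𝟘 k → k ≤ 1
  HasOrder-𝟘⇒≤1 (_ , _ , minimal) = minimal 1 ≤-refl (·-identityˡ 𝟘)

  HasOrder-[] : ∀ {q h} → n ≡ q * h → HasOrder [ h ] q
  HasOrder-[] {q} {h} n≡qh = n≢0⇒n>0 q≢0 , q·[h]≡𝟘 , minimal
    where
    q≢0 : q ≢ 0
    q≢0 refl = ≢-nonZero⁻¹ n n≡qh
    h≢0 : h ≢ 0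
    h≢0 refl = ≢-nonZero⁻¹ n (trans n≡qh (*-zeroʳ q))
    q·[h]≡𝟘 : q · [ h ] ≡ 𝟘
    q·[h]≡𝟘 = trans ([]-* q h) (∣⇒[]≡𝟘 (∣-reflexive n≡qh))
    minimal : ∀ j → 1 ≤ j → j · [ h ] ≡ 𝟘 → q ≤ j
    minimal j 1≤j j·[h]≡𝟘 = ∣⇒≤ {{>-nonZero 1≤j}} (*-cancelʳ-∣ h {{≢-nonZero h≢0}}
      (subst (_∣ j * h) n≡qh ([]≡𝟘⇒∣ (trans (sym ([]-* j h)) j·[h]≡𝟘))))

  cofactor·≡𝟘 : ∀ {w g r} → g ∣ toℕ w → n ≡ r * g → r · w ≡ 𝟘
  cofactor·≡𝟘 {w} {g} {r} g∣w n≡rg = ∣⇒[]≡𝟘 (subst (_∣ r * toℕ w) (sym n≡rg) (*-monoʳ-∣ r g∣w))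

  cofactor-≤⇒∣-≡ : ∀ {g h q r} → n ≡ r * g → n ≡ q * h → q ≤ r → h ∣ g → h ≡ g
  cofactor-≤⇒∣-≡ {g} {h} {q} {r} n≡rg n≡qh q≤r h∣g = ≤-antisym (∣⇒≤ {{≢-nonZero g≢0}} h∣g) g≤h
    where
    r≢0 : r ≢ 0
    r≢0 refl = ≢-nonZero⁻¹ n n≡rg
    g≢0 : g ≢ 0
    g≢0 refl = ≢-nonZero⁻¹ n (trans n≡rg (*-zeroʳ r))
    g≤h : g ≤ h
    g≤h = *-cancelˡ-≤ r {{≢-nonZero r≢0}}
      (subst (_≤ r * h) (trans (sym n≡qh) n≡rg) (*-monoˡ-≤ h q≤r))

  maximal-order-generates : ∀ {P w k} → IsSubmonoid P → P w → HasOrder w k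
    → (∀ x k′ → P x → HasOrder x k′ → k′ ≤ k)
    → ∀ {δ} → P δ → δ ∈⟨ w ⟩
  maximal-order-generates {P} {w} {k} P-sub Pw (_ , _ , w-minimal) maximal {δ} Pδ =
    subst (_∈⟨ w ⟩) ([toℕ] δ) (subst (λ c → [ c ] ∈⟨ w ⟩) (sym (m∣n⇒n≡quotient*m g∣b))
      ([]-*-closed w-sub (quotient g∣b) (gcd-n-closed w-sub (1 , sym (·-identityˡ w)))))
    where
    w-sub : IsSubmonoid (_∈⟨ w ⟩)
    w-sub = ⟨⟩-isSubmonoid w
    g h : ℕ
    g = gcd (toℕ w) n
    h = gcd g (toℕ δ)
    g∣n : g ∣ n
    g∣n = gcd[m,n]∣n (toℕ w) n
    h∣g : h ∣ g
    h∣g = gcd[m,n]∣m g (toℕ δ)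
    r q : ℕ
    r = quotient g∣n
    q = quotient (∣-trans h∣g g∣n)
    n≡rg : n ≡ r * g
    n≡rg = m∣n⇒n≡quotient*m g∣n
    n≡qh : n ≡ q * h
    n≡qh = m∣n⇒n≡quotient*m (∣-trans h∣g g∣n)
    q≤k : q ≤ k
    q≤k = maximal [ h ] q
      (gcd-closed P-sub (gcd-n-closed P-sub Pw) (subst P (sym ([toℕ] δ)) Pδ)) (HasOrder-[] n≡qh)
    k≤r : k ≤ r
    k≤r = w-minimal r (n≢0⇒n>0 (λ r≡0 → ≢-nonZero⁻¹ n (trans n≡rg (cong (_* g) r≡0))))
      (cofactor·≡𝟘 {w} {r = r} (gcd[m,n]∣m (toℕ w) n) n≡rg)
    g∣b : g ∣ toℕ δ
    g∣b = subst (_∣ toℕ δ) (cofactor-≤⇒∣-≡ n≡rg n≡qh (≤-trans q≤k k≤r) h∣g) (gcd[m,n]∣n g (toℕ δ))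

module _ {n : ℕ} .{{_ : NonZero n}} (A : Subset n) where

  open AbelianGroupProperties ⊕-abelianGroup
    using (xyx⁻¹≈y; x∙y⁻¹≈ε⇒x≈y; //-rightDividesˡ; //-rightDividesʳ; identityʳ-unique)
  open IsSubmonoid

  Period : Fin n → Set
  Period d = ∀ z → z ∈A∪0 A → (z ⊕ d) ∈A∪0 A

  Period-isSubmonoid : IsSubmonoid Period
  Period-isSubmonoid = record
    { 𝟘-closed = λ z z∈ → subst (_∈A∪0 A) (sym (⊕-identityʳ z)) z∈
    ; ⊕-closed = λ {d} {e} pd pe z z∈ → subst (_∈A∪0 A) (⊕-assoc z d e) (pe (z ⊕ d) (pd z z∈))
    }

  Period⇒∈A∪0 : ∀ {d} → Period d → d ∈A∪0 A
  Period⇒∈A∪0 {d} pd = subst (_∈A∪0 A) (⊕-identityˡ d) (pd 𝟘 (inj₂ refl))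

  UnionOfCosets⇔Period : ∀ {w} → UnionOfCosets A w ⇔ Period w
  UnionOfCosets⇔Period {w} = mk⇔
    (λ cosets z z∈ → cosets z z∈ (z ⊕ w) (1 , cong (z ⊕_) (sym (·-identityˡ w))))
    (λ pw x x∈ → λ { _ (k , refl) → ·-closed Period-isSubmonoid k pw x x∈ })

  IsUnit∧Period⇒IsComplete : ∀ {d} → IsUnit d → Period d → IsComplete A
  IsUnit∧Period⇒IsComplete {d} unit pd u v u≢v =
    [ id , (λ u⊖v≡𝟘 → ⊥-elim (u≢v (x∙y⁻¹≈ε⇒x≈y u v u⊖v≡𝟘))) ]′ (Period⇒∈A∪0 period-u⊖v)
    where
    period-u⊖v : Period (u ⊖ v)
    period-u⊖v with IsUnit⇒generates unit (u ⊖ v)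
    ... | j , u⊖v≡j·d = subst Period (sym u⊖v≡j·d) (·-closed Period-isSubmonoid j pd)

  ∈N[]⇔∈A∪0 : ∀ {u x z} → x ⊕ z ≡ u → x ∈N[ u ] A ⇔ z ∈A∪0 A
  ∈N[]⇔∈A∪0 {u} {x} {z} x⊕z≡u = mk⇔
    (λ { (inj₁ x≡u) → inj₂ (identityʳ-unique x z (trans x⊕z≡u (sym x≡u)))
       ; (inj₂ u⊖x∈A) → inj₁ (subst (_∈ A) u⊖x≡z u⊖x∈A) })
    (λ { (inj₁ z∈A) → inj₂ (subst (_∈ A) (sym u⊖x≡z) z∈A)
       ; (inj₂ z≡𝟘) → inj₁ (trans (sym (⊕-identityʳ x)) (trans (cong (x ⊕_) (sym z≡𝟘)) x⊕z≡u)) })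
    where
    u⊖x≡z : u ⊖ x ≡ z
    u⊖x≡z = trans (cong (_⊖ x) (sym x⊕z≡u)) (xyx⁻¹≈y x z)

  ∈N[]-translate : ∀ {d u x} → Period d → x ∈N[ u ] A → x ∈N[ u ⊕ d ] A
  ∈N[]-translate {d} {u} {x} pd x∈N[u] =
    from (∈N[]⇔∈A∪0 x⊕z⊕d≡u⊕d) (pd z (to (∈N[]⇔∈A∪0 x⊕z≡u) x∈N[u]))
    where
    z : Fin n
    z = u ⊖ x
    x⊕z≡u : x ⊕ z ≡ u
    x⊕z≡u = ⊕-⊖-cancel x u
    x⊕z⊕d≡u⊕d : x ⊕ (z ⊕ d) ≡ u ⊕ d
    x⊕z⊕d≡u⊕d = trans (sym (⊕-assoc x z d)) (cong (_⊕ d) x⊕z≡u)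

  Period⇒SameClosedNbhd : ∀ {d} u → Period d → SameClosedNbhd A u (u ⊕ d)
  Period⇒SameClosedNbhd {d} u pd x = mk⇔ (∈N[]-translate pd)
    (λ x∈N[u⊕d] → subst (λ v → x ∈N[ v ] A) (//-rightDividesʳ d u)
      (∈N[]-translate (⊝-closed Period-isSubmonoid pd) x∈N[u⊕d]))

  SameClosedNbhd⇒Period : ∀ {u v} → SameClosedNbhd A u v → Period (v ⊖ u)
  SameClosedNbhd⇒Period {u} {v} same z z∈ =
    to (∈N[]⇔∈A∪0 x⊕z⊕[v⊖u]≡v) (to (same x) (from (∈N[]⇔∈A∪0 x⊕z≡u) z∈))
    where
    x : Fin n
    x = u ⊖ z
    x⊕z≡u : x ⊕ z ≡ u
    x⊕z≡u = //-rightDividesˡ z u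
    x⊕z⊕[v⊖u]≡v : x ⊕ (z ⊕ (v ⊖ u)) ≡ v
    x⊕z⊕[v⊖u]≡v = trans (sym (⊕-assoc x z (v ⊖ u)))
      (trans (cong (_⊕ (v ⊖ u)) x⊕z≡u) (⊕-⊖-cancel u v))

  module _ (incomplete : ¬ IsComplete A) where

    Good⇔≢𝟘×Period : ∀ {w} → Good A w ⇔ (w ≢ 𝟘 × Period w)
    Good⇔≢𝟘×Period = mk⇔
      (λ (w≢𝟘 , _ , cosets) → w≢𝟘 , to UnionOfCosets⇔Period cosets)
      (λ (w≢𝟘 , pw) → w≢𝟘 , (λ unit → incomplete (IsUnit∧Period⇒IsComplete unit pw))
                          , from UnionOfCosets⇔Period pw)

    HasAdjacentTwins⇔∃Good : HasAdjacentTwins A ⇔ (∃ λ w → Good A w)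
    HasAdjacentTwins⇔∃Good = mk⇔
      (λ (u , v , u≢v , same) → v ⊖ u , from Good⇔≢𝟘×Period
        ((λ v⊖u≡𝟘 → u≢v (sym (x∙y⁻¹≈ε⇒x≈y v u v⊖u≡𝟘))) , SameClosedNbhd⇒Period same))
      (λ (w , good) → let (w≢𝟘 , pw) = to Good⇔≢𝟘×Period good in
        𝟘 , 𝟘 ⊕ w , (λ 𝟘≡𝟘⊕w → w≢𝟘 (identityʳ-unique 𝟘 w (sym 𝟘≡𝟘⊕w))) , Period⇒SameClosedNbhd 𝟘 pw)

    module _ {w k} (good : Good A w) (w-order : HasOrder w k)
             (maximal : ∀ w′ k′ → Good A w′ → HasOrder w′ k′ → k′ ≤ k) where

      Period⇒∈⟨⟩ : ∀ {δ} → Period δ → δ ∈⟨ w ⟩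
      Period⇒∈⟨⟩ = maximal-order-generates Period-isSubmonoid
        (proj₂ (to Good⇔≢𝟘×Period good)) w-order maximal-period
        where
        maximal-period : ∀ x k′ → Period x → HasOrder x k′ → k′ ≤ k
        maximal-period x k′ px x-order with x ≟ 𝟘
        ... | yes refl = ≤-trans (HasOrder-𝟘⇒≤1 x-order) (proj₁ w-order)
        ... | no x≢𝟘   = maximal x k′ (from Good⇔≢𝟘×Period (x≢𝟘 , px)) x-order

      SameClosedNbhd⇔∈+⟨⟩ : ∀ u v → SameClosedNbhd A u v ⇔ v ∈ u +⟨ w ⟩
      SameClosedNbhd⇔∈+⟨⟩ u v = mk⇔
        (λ same → ⊖∈⟨⟩⇒∈+⟨⟩ (Period⇒∈⟨⟩ (SameClosedNbhd⇒Period same)))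
        (λ { (j , refl) → Period⇒SameClosedNbhd u
               (·-closed Period-isSubmonoid j (proj₂ (to Good⇔≢𝟘×Period good))) })

corollary18 : (n : ℕ) .{{_ : NonZero n}} (A : Subset n)
    → 𝟘 ∉ A
    → (∀ x → x ∈ A → (⊝ x) ∈ A)
    → ¬ IsComplete A
    → (HasAdjacentTwins A ⇔ (∃ λ w → Good A w))
      × (∀ w k → Good A w → HasOrder w k
           → (∀ w′ k′ → Good A w′ → HasOrder w′ k′ → k′ ≤ k)
           → ∀ u v → SameClosedNbhd A u v ⇔ v ∈ u +⟨ w ⟩)
corollary18 n A _ _ incomplete =
  HasAdjacentTwins⇔∃Good A incomplete ,
  λ w k good w-order maximal → SameClosedNbhd⇔∈+⟨⟩ A incomplete good w-order maximal
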